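{- For every general $\rightsquigarrow$-frame $\mathfrak G=(X,\preceq,\sqsubset,P)$, the general $\rightsquigarrow$-frame $\hat\rho\hat\sigma\mathfrak G$ is isomorphic to $\mathfrak G$ (via $x\mapsto\{x\}$), and these isomorphisms are natural in $\mathfrak G$; i.e. $\hat\rho\hat\sigma\cong\mathrm{id}$ as functors on the category of general $\rightsquigarrow$-frames. In particular $\hat\rho\hat\sigma P=P$ under the identification of $X$ with the set of its singletons.
   Context: A $\rightsquigarrow$-frame is $(X,\preceq,\sqsubset)$ with $\preceq$ a partial order and $\sqsubset$ a relation such that $x\preceq y\sqsubset z$ implies $x\sqsubset z$. For upsets $a,b$: $a\underline{\to}b=\{x:\forall y(x\preceq y,y\in a\Rightarrow y\in b)\}$, $a\underline{\rightsquigarrow}b=\{x:\forall y(x\sqsubset y,y\in a\Rightarrow y\in b)\}$. A general $\rightsquigarrow$-frame $(X,\preceq,\sqsubset,P)$ has $P$ a family of upsets containing $X,\emptyset$ closed under $\cap,\cup,\underline{\to},\underline{\rightsquigarrow}$; its morphisms are maps $f$ that for each $R\in\{\preceq,\sqsubset\}$ preserve $R$ and satisfy the back condition ($f(x)R'z'$ implies $xRz$ and $f(z)=z'$ for some $z$), with $f^{ -1}(a')\in P$ for $a'\in P'$. $\hat\sigma\mathfrak G=(X,\preceq,\sqsubset,\hat\sigma P)$ where $\hat\sigma P$ is the Boolean closure of $P$ in the powerset of $X$; $\hat\sigma f=f$. This is a general $\mathsf{S4K}$-frame $(X,R_i,R_m,Q)$: $R_i$ a preorder, $R_m$ a relation,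 $Q$ a Boolean algebra of subsets closed under $[i]a=\{x:\forall y(xR_iy\Rightarrow y\in a)\}$ and $[m]a=\{x:\forall y(xR_my\Rightarrow y\in a)\}$. For a general $\mathsf{S4K}$-frame $\mathfrak F=(X,R_i,R_m,Q)$: let $R_m^*$ be given by $xR_m^*z$ iff $xR_iyR_mz$ for some $y$; let $x\sim y$ iff $xR_iy$ and $yR_ix$, let $[x]$ be the class ("cluster") of $x$ and $[X]$ the set of clusters; $[x][R_i][y]$ iff $xR_iy$ (a partial order); $[x][R_m^*][y]$ iff $xR_m^*y'$ for some $y'\sim y$; for $a\subseteq X$, $[a]=\{[x]:x\in a\}$; $[Q]=\{\mathcal A\subseteq[X]:\bigcup\mathcal A\in Q\}$; $\hat\rho Q=\{[i]\mathcal A:\mathcal A\in[Q]\}$, where $[i]$ on sets of clusters is computed w.r.t. $[R_i]$. Then $\hat\rho\mathfrak F=([X],[R_i],[R_m^*],\hat\rho Q)$ and $\hat\rho f([x])=[f(x)]$. -}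

module Defs where

open import Level using (0ℓ) renaming (suc to lsuc)
open import Data.Product using (Σ; ∃; _×_; _,_; proj₁; proj₂)
open import Data.Sum using (_⊎_)
open import Data.Empty using (⊥)
open import Data.Unit using (⊤)
open import Relation.Nullary using (¬_)
open import Relation.Binary.PropositionalEquality using (_≡_)
open import Relation.Binary.Structures using (IsEquivalence; IsPartialOrder)

Subset : Set → Set₁
Subset X = X → Set

_≐_ : {X : Set} → Subset X → Subset X → Set
_≐_ {X} a b = ∀ (x : X) → (a x → b x) × (b x → a x)

∅ₛ : {X : Set} → Subset X
∅ₛ _ = ⊥

Xₛ : {X : Set} → Subset X
Xₛ _ = ⊤

_∩ₛ_ : {X : Set} → Subset X → Subset X → Subset X
(a ∩ₛ b) x = a x × b x

_∪ₛ_ : {X : Set} → Subset X → Subset X → Subset X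
(a ∪ₛ b) x = a x ⊎ b x

∁ₛ : {X : Set} → Subset X → Subset X
∁ₛ a x = ¬ a x

-- a R⇒ b = {x : ∀ y (x R y, y ∈ a ⇒ y ∈ b)}  (gives → underlined for R = ⪯,
-- ⇝ underlined for R = ⊏)
arr : {X : Set} → (X → X → Set) → Subset X → Subset X → Subset X
arr R a b x = ∀ y → R x y → a y → b y

box : {X : Set} → (X → X → Set) → Subset X → Subset X
box R a x = ∀ y → R x y → a y

IsUpset : {X : Set} → (X → X → Set) → Subset X → Set
IsUpset R a = ∀ {x y} → R x y → a x → a y

-- For the paper's
-- frames (sets) ≈ is ≡; the carrier of ρ̂ F is the set of clusters,
-- represented setoid-style (a cluster by any of its members, ≈ = ∼).

record FrameData : Set₂ where
  field
    Carrier : Set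
    _≈_ : Carrier → Carrier → Set
    _⪯_ : Carrier → Carrier → Set
    _⊏_ : Carrier → Carrier → Set
    P   : Subset Carrier → Set₁

record IsGenFrame (F : FrameData) : Set₁ where
  open FrameData F
  field
    ≈-isEquivalence : IsEquivalence _≈_
    ⪯-isPartialOrder : IsPartialOrder _≈_ _⪯_
    ⊏-respˡ : ∀ {x x' z} → x ≈ x' → x ⊏ z → x' ⊏ z
    ⊏-respʳ : ∀ {x z z'} → z ≈ z' → x ⊏ z → x ⊏ z'
    mix : ∀ {x y z} → x ⪯ y → y ⊏ z → x ⊏ z
    -- P is a family of sets (membership is extensional)
    P-ext : ∀ {a b} → P a → a ≐ b → P b
    P-upset : ∀ {a} → P a → IsUpset _⪯_ a
    P-X : P Xₛ
    P-∅ : P ∅ₛ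
    P-∩ : ∀ {a b} → P a → P b → P (a ∩ₛ b)
    P-∪ : ∀ {a b} → P a → P b → P (a ∪ₛ b)
    P-→ : ∀ {a b} → P a → P b → P (arr _⪯_ a b)
    P-⇝ : ∀ {a b} → P a → P b → P (arr _⊏_ a b)

record IsMorphism (F F' : FrameData)
                  (f : FrameData.Carrier F → FrameData.Carrier F') : Set₁ where
  private
    module F = FrameData F
    module F' = FrameData F'
  field
    f-cong : ∀ {x y} → x F.≈ y → f x F'.≈ f y
    ⪯-pres : ∀ {x y} → x F.⪯ y → f x F'.⪯ f y
    ⊏-pres : ∀ {x y} → x F.⊏ y → f x F'.⊏ f y
    ⪯-back : ∀ {x z'} → f x F'.⪯ z' → ∃ λ z → (x F.⪯ z) × (f z F'.≈ z')
    ⊏-back : ∀ {x z'} → f x F'.⊏ z' → ∃ λ z → (x F.⊏ z) × (f z F'.≈ z')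
    P-preimage : ∀ {a'} → F'.P a' → F.P (λ x → a' (f x))

IsIso : (F F' : FrameData) → (FrameData.Carrier F → FrameData.Carrier F') → Set₁
IsIso F F' f =
  IsMorphism F F' f ×
  Σ (FrameData.Carrier F' → FrameData.Carrier F) λ g →
    IsMorphism F' F g ×
    (∀ x → FrameData._≈_ F (g (f x)) x) ×
    (∀ y → FrameData._≈_ F' (f (g y)) y)

plainData : (X : Set) → (X → X → Set) → (X → X → Set) → (Subset X → Set₁) → FrameData
plainData X ⪯ ⊏ P = record { Carrier = X ; _≈_ = _≡_ ; _⪯_ = ⪯ ; _⊏_ = ⊏ ; P = P }

record GFrame : Set₂ where
  field
    X : Set
    _⪯_ : X → X → Set
    _⊏_ : X → X → Set
    P : Subset X → Set₁
  data' : FrameData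
  data' = plainData X _⪯_ _⊏_ P
  field
    isGenFrame : IsGenFrame data'

record S4KData : Set₂ where
  field
    X  : Set
    Ri : X → X → Set
    Rm : X → X → Set
    Q  : Subset X → Set₁

data BoolClo {X : Set} (P : Subset X → Set₁) : Subset X → Set₁ where
  gen  : ∀ {a} → P a → BoolClo P a
  cmp  : ∀ {a} → BoolClo P a → BoolClo P (∁ₛ a)
  meet : ∀ {a b} → BoolClo P a → BoolClo P b → BoolClo P (a ∩ₛ b)
  join : ∀ {a b} → BoolClo P a → BoolClo P b → BoolClo P (a ∪ₛ b)
  ext  : ∀ {a b} → BoolClo P a → a ≐ b → BoolClo P b

σ̂ : GFrame → S4KData
σ̂ G = record { X = X ; Ri = _⪯_ ; Rm = _⊏_ ; Q = BoolClo P }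
  where open GFrame G

σ̂map : {A B : Set} → (A → B) → (A → B)
σ̂map f = f

-- ρ̂ 𝔉 = ([X], [R_i], [R_m*], ρ̂Q).  Clusters are represented by their
-- members, with x ≈ y iff x ∼ y; a set of clusters 𝒜 ⊆ [X] is a
-- ∼-closed subset of X (namely ⋃𝒜).
module _ (F : S4KData) where
  open S4KData F

  _∼_ : X → X → Set
  x ∼ y = Ri x y × Ri y x

  Rm* : X → X → Set
  Rm* x z = ∃ λ y → Ri x y × Rm y z

  ρ̂ : FrameData
  ρ̂ = record
    { Carrier = X
    ; _≈_ = _∼_
    ; _⪯_ = Ri
    ; _⊏_ = λ x y → ∃ λ y' → (y' ∼ y) × Rm* x y'
    ; P = λ b → ∃ λ 𝒜 → (∀ {x y} → x ∼ y → 𝒜 x → 𝒜 y)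
                      × Q 𝒜
                      × (b ≐ box Ri 𝒜)
    }

-- ρ̂ f ([x]) = [f x]  (on representatives)
ρ̂map : {A B : Set} → (A → B) → (A → B)
ρ̂map f = f

ρ̂σ̂ : GFrame → FrameData
ρ̂σ̂ G = ρ̂ (σ̂ G)

-- the map x ↦ {x} = [x]  (on representatives)
η : (G : GFrame) → GFrame.X G → FrameData.Carrier (ρ̂σ̂ G)
η G x = x

{-# OPTIONS --safe #-}
-- Since ⪯ is antisymmetric, the clusters of σ̂𝔊 are singletons: ρ̂σ̂𝔊 has the carrier
-- and the order of 𝔊, its R_m* collapses to ⊏ by the mixing law, and η is the identity.
-- The real content is ρ̂σ̂P = P.  Classically, every member of the Boolean closure of the
-- bounded lattice P is a finite meet of clauses ∁ l ∪ r with l, r ∈ P, and [⪯] sends such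
-- a meet to the meet of the implications l → r, which lies in P; conversely every a ∈ P is
-- an upset, so a = [⪯]a.  Naturality is then the composite η' ∘ f ∘ η⁻¹.
module Submission where

open import Defs
open import Level using (0ℓ; lift; lower) renaming (suc to lsuc)
open import Axiom.ExcludedMiddle using (ExcludedMiddle)
open import Axiom.DoubleNegationElimination using (em⇒dne)
open import Function using (id; _∘_; _∘₂_)
open import Data.Product using (∃; _×_; _,_; proj₁; proj₂)
open import Data.Sum using (_⊎_; inj₁; inj₂; [_,_]; [_,_]′)
open import Data.Unit using (tt)
open import Data.List using (List; []; _∷_; _++_; map)
open import Relation.Nullary using (¬_; yes; no; contradiction)
open import Relation.Nullary.Decidable using (map′)
open import Relation.Binary.PropositionalEquality using (_≡_; refl; subst; isEquivalence)
open import Relation.Binary.Structures using (IsEquivalence; IsPartialOrder)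
open import Relation.Binary.Bundles using (Setoid)

lowerExcludedMiddle : ExcludedMiddle (lsuc 0ℓ) → ExcludedMiddle 0ℓ
lowerExcludedMiddle em = map′ lower lift em

module _ {X : Set} where

  ≐-refl : {a : Subset X} → a ≐ a
  ≐-refl x = id , id

  ≐-sym : {a b : Subset X} → a ≐ b → b ≐ a
  ≐-sym e x = proj₂ (e x) , proj₁ (e x)

  ≐-trans : {a b c : Subset X} → a ≐ b → b ≐ c → a ≐ c
  ≐-trans e f x = proj₁ (f x) ∘ proj₁ (e x) , proj₂ (e x) ∘ proj₂ (f x)

  ∩-cong : {a b c d : Subset X} → a ≐ b → c ≐ d → (a ∩ₛ c) ≐ (b ∩ₛ d)
  ∩-cong e f x = (λ (p , q) → proj₁ (e x) p , proj₁ (f x) q)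
               , (λ (p , q) → proj₂ (e x) p , proj₂ (f x) q)

  ∪-cong : {a b c d : Subset X} → a ≐ b → c ≐ d → (a ∪ₛ c) ≐ (b ∪ₛ d)
  ∪-cong e f x = (λ { (inj₁ p) → inj₁ (proj₁ (e x) p) ; (inj₂ q) → inj₂ (proj₁ (f x) q) })
               , (λ { (inj₁ p) → inj₁ (proj₂ (e x) p) ; (inj₂ q) → inj₂ (proj₂ (f x) q) })

  ∁-cong : {a b : Subset X} → a ≐ b → ∁ₛ a ≐ ∁ₛ b
  ∁-cong e x = (λ ¬a b → ¬a (proj₂ (e x) b)) , (λ ¬b a → ¬b (proj₁ (e x) a))

  box-cong : (R : X → X → Set) {a b : Subset X} → a ≐ b → box R a ≐ box R b
  box-cong R e x = (λ h y r → proj₁ (e y) (h y r)) , (λ h y r → proj₂ (e y) (h y r))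

  ∁-∪ : {a b : Subset X} → ∁ₛ (a ∪ₛ b) ≐ (∁ₛ a ∩ₛ ∁ₛ b)
  ∁-∪ x = (λ n → n ∘ inj₁ , n ∘ inj₂) , (λ { (¬a , ¬b) → [ ¬a , ¬b ] })

  ∪-distribˡ-∩ : {a b c : Subset X} → (a ∪ₛ (b ∩ₛ c)) ≐ ((a ∪ₛ b) ∩ₛ (a ∪ₛ c))
  ∪-distribˡ-∩ x =
      (λ { (inj₁ p) → inj₁ p , inj₁ p ; (inj₂ (q , r)) → inj₂ q , inj₂ r })
    , (λ { (inj₁ p , _) → inj₁ p ; (_ , inj₁ p) → inj₁ p ; (inj₂ q , inj₂ r) → inj₂ (q , r) })

  ∪-distribʳ-∩ : {a b c : Subset X} → ((a ∩ₛ b) ∪ₛ c) ≐ ((a ∪ₛ c) ∩ₛ (b ∪ₛ c))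
  ∪-distribʳ-∩ x =
      (λ { (inj₁ (p , q)) → inj₁ p , inj₁ q ; (inj₂ r) → inj₂ r , inj₂ r })
    , (λ { (_ , inj₂ r) → inj₂ r ; (inj₂ r , _) → inj₂ r ; (inj₁ p , inj₁ q) → inj₁ (p , q) })

  box-∩ : (R : X → X → Set) {a b : Subset X} → box R (a ∩ₛ b) ≐ (box R a ∩ₛ box R b)
  box-∩ R x = (λ h → proj₁ ∘₂ h , proj₂ ∘₂ h) , (λ (f , g) y r → f y r , g y r)

  module Classical (em : ExcludedMiddle 0ℓ) where

    ∁-∁ : {a : Subset X} → ∁ₛ (∁ₛ a) ≐ a
    ∁-∁ x = em⇒dne em , λ a ¬a → ¬a a

    ∁-∩ : {a b : Subset X} → ∁ₛ (a ∩ₛ b) ≐ (∁ₛ a ∪ₛ ∁ₛ b)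
    ∁-∩ {a} {b} x = to , (λ { (inj₁ ¬a) (p , _) → ¬a p ; (inj₂ ¬b) (_ , q) → ¬b q })
      where
      to : ¬ (a x × b x) → ¬ a x ⊎ ¬ b x
      to n with em {a x}
      ... | yes p = inj₂ (λ q → n (p , q))
      ... | no ¬p = inj₁ ¬p

    box-∁∪ : (R : X → X → Set) {a b : Subset X} → box R (∁ₛ a ∪ₛ b) ≐ arr R a b
    box-∁∪ R {a} {b} x =
        (λ h y r p → implies (h y r) p)
      , (λ h y r → excluded (h y r))
      where
      implies : ∀ {y} → (∁ₛ a ∪ₛ b) y → a y → b y
      implies (inj₁ ¬p) p = contradiction p ¬p
      implies (inj₂ q)  _ = q
      excluded : ∀ {y} → (a y → b y) → (∁ₛ a ∪ₛ b) y
      excluded {y} f with em {a y}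
      ... | yes p = inj₂ (f p)
      ... | no ¬p = inj₁ ¬p

subset-setoid : Set → Setoid (lsuc 0ℓ) 0ℓ
subset-setoid X = record
  { Carrier = Subset X
  ; _≈_ = _≐_
  ; isEquivalence = record { refl = ≐-refl ; sym = ≐-sym ; trans = ≐-trans }
  }

module NormalForm
  (em : ExcludedMiddle 0ℓ) {X : Set} (P : Subset X → Set₁)
  (P-X : P Xₛ) (P-∅ : P ∅ₛ)
  (P-∩ : ∀ {a b} → P a → P b → P (a ∩ₛ b))
  (P-∪ : ∀ {a b} → P a → P b → P (a ∪ₛ b))
  where

  open Classical {X = X} em
  open import Relation.Binary.Reasoning.Setoid (subset-setoid X)

  record Clause : Set₁ where
    constructor _⇒_
    field
      {premise conclusion} : Subset X
      premise∈P : P premise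
      conclusion∈P : P conclusion
  open Clause

  ⟦_⟧ : Clause → Subset X
  ⟦ c ⟧ = ∁ₛ (premise c) ∪ₛ conclusion c

  ⋀ : List Clause → Subset X
  ⋀ [] = Xₛ
  ⋀ (c ∷ cs) = ⟦ c ⟧ ∩ₛ ⋀ cs

  IsCNF : Subset X → Set₁
  IsCNF a = ∃ λ cs → a ≐ ⋀ cs

  IsCNF-resp-≐ : ∀ {a b} → a ≐ b → IsCNF a → IsCNF b
  IsCNF-resp-≐ e (cs , a≐cs) = cs , ≐-trans (≐-sym e) a≐cs

  ⋀-++ : ∀ cs ds → ⋀ (cs ++ ds) ≐ (⋀ cs ∩ₛ ⋀ ds)
  ⋀-++ [] ds x = (tt ,_) , proj₂
  ⋀-++ (c ∷ cs) ds x =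
      (λ (p , q) → let (r , s) = proj₁ (⋀-++ cs ds x) q in (p , r) , s)
    , (λ ((p , r) , s) → p , proj₂ (⋀-++ cs ds x) (r , s))

  _∨_ : Clause → Clause → Clause
  c ∨ d = P-∩ (premise∈P c) (premise∈P d) ⇒ P-∪ (conclusion∈P c) (conclusion∈P d)

  ⟦∨⟧ : ∀ c d → ⟦ c ∨ d ⟧ ≐ (⟦ c ⟧ ∪ₛ ⟦ d ⟧)
  ⟦∨⟧ c d x = to , from
    where
    to : ⟦ c ∨ d ⟧ x → (⟦ c ⟧ ∪ₛ ⟦ d ⟧) x
    to (inj₁ ¬both) = [ inj₁ ∘ inj₁ , inj₂ ∘ inj₁ ]′ (proj₁ (∁-∩ {a = premise c} {b = premise d} x) ¬both)
    to (inj₂ (inj₁ q)) = inj₁ (inj₂ q)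
    to (inj₂ (inj₂ q)) = inj₂ (inj₂ q)
    from : (⟦ c ⟧ ∪ₛ ⟦ d ⟧) x → ⟦ c ∨ d ⟧ x
    from (inj₁ (inj₁ ¬p)) = inj₁ (¬p ∘ proj₁)
    from (inj₁ (inj₂ q)) = inj₂ (inj₁ q)
    from (inj₂ (inj₁ ¬p)) = inj₁ (¬p ∘ proj₂)
    from (inj₂ (inj₂ q)) = inj₂ (inj₂ q)

  ⋀-∨ˡ : ∀ c ds → ⋀ (map (c ∨_) ds) ≐ (⟦ c ⟧ ∪ₛ ⋀ ds)
  ⋀-∨ˡ c [] x = (λ _ → inj₂ tt) , (λ _ → tt)
  ⋀-∨ˡ c (d ∷ ds) = begin
    ⟦ c ∨ d ⟧ ∩ₛ ⋀ (map (c ∨_) ds)       ≈⟨ ∩-cong (⟦∨⟧ c d) (⋀-∨ˡ c ds) ⟩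
    (⟦ c ⟧ ∪ₛ ⟦ d ⟧) ∩ₛ (⟦ c ⟧ ∪ₛ ⋀ ds)  ≈⟨ ∪-distribˡ-∩ ⟨
    ⟦ c ⟧ ∪ₛ (⟦ d ⟧ ∩ₛ ⋀ ds)             ∎

  _⊗_ : List Clause → List Clause → List Clause
  [] ⊗ ds = []
  (c ∷ cs) ⊗ ds = map (c ∨_) ds ++ (cs ⊗ ds)

  ⋀-⊗ : ∀ cs ds → ⋀ (cs ⊗ ds) ≐ (⋀ cs ∪ₛ ⋀ ds)
  ⋀-⊗ [] ds x = (λ _ → inj₁ tt) , (λ _ → tt)
  ⋀-⊗ (c ∷ cs) ds = begin
    ⋀ (map (c ∨_) ds ++ (cs ⊗ ds))       ≈⟨ ⋀-++ (map (c ∨_) ds) (cs ⊗ ds) ⟩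
    ⋀ (map (c ∨_) ds) ∩ₛ ⋀ (cs ⊗ ds)     ≈⟨ ∩-cong (⋀-∨ˡ c ds) (⋀-⊗ cs ds) ⟩
    (⟦ c ⟧ ∪ₛ ⋀ ds) ∩ₛ (⋀ cs ∪ₛ ⋀ ds)    ≈⟨ ∪-distribʳ-∩ ⟨
    (⟦ c ⟧ ∩ₛ ⋀ cs) ∪ₛ ⋀ ds              ∎

  IsCNF-∩ : ∀ {a b} → IsCNF a → IsCNF b → IsCNF (a ∩ₛ b)
  IsCNF-∩ (cs , a≐) (ds , b≐) = cs ++ ds , ≐-trans (∩-cong a≐ b≐) (≐-sym (⋀-++ cs ds))

  IsCNF-∪ : ∀ {a b} → IsCNF a → IsCNF b → IsCNF (a ∪ₛ b)
  IsCNF-∪ (cs , a≐) (ds , b≐) = cs ⊗ ds , ≐-trans (∪-cong a≐ b≐) (≐-sym (⋀-⊗ cs ds))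

  P⇒IsCNF : ∀ {a} → P a → IsCNF a
  P⇒IsCNF pa = (P-X ⇒ pa) ∷ [] , λ x →
      (λ p → inj₂ p , tt)
    , (λ { (inj₁ ¬⊤ , _) → contradiction tt ¬⊤ ; (inj₂ p , _) → p })

  ∁P⇒IsCNF : ∀ {a} → P a → IsCNF (∁ₛ a)
  ∁P⇒IsCNF pa = (pa ⇒ P-∅) ∷ [] , λ x → (λ ¬a → inj₁ ¬a , tt) , λ { (inj₁ ¬a , _) → ¬a }

  ∁⟦⟧ : ∀ c → ∁ₛ ⟦ c ⟧ ≐ (premise c ∩ₛ ∁ₛ (conclusion c))
  ∁⟦⟧ c = begin
    ∁ₛ (∁ₛ (premise c) ∪ₛ conclusion c)        ≈⟨ ∁-∪ ⟩
    ∁ₛ (∁ₛ (premise c)) ∩ₛ ∁ₛ (conclusion c)   ≈⟨ ∩-cong ∁-∁ ≐-refl ⟩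
    premise c ∩ₛ ∁ₛ (conclusion c)             ∎

  IsCNF-∁⋀ : ∀ cs → IsCNF (∁ₛ (⋀ cs))
  IsCNF-∁⋀ [] = ∁P⇒IsCNF P-X
  IsCNF-∁⋀ (c ∷ cs) = IsCNF-resp-≐ (≐-sym ∁-∩) (IsCNF-∪ ∁c-cnf (IsCNF-∁⋀ cs))
    where
    ∁c-cnf : IsCNF (∁ₛ ⟦ c ⟧)
    ∁c-cnf = IsCNF-resp-≐ (≐-sym (∁⟦⟧ c))
               (IsCNF-∩ (P⇒IsCNF (premise∈P c)) (∁P⇒IsCNF (conclusion∈P c)))

  IsCNF-∁ : ∀ {a} → IsCNF a → IsCNF (∁ₛ a)
  IsCNF-∁ (cs , a≐) = IsCNF-resp-≐ (∁-cong (≐-sym a≐)) (IsCNF-∁⋀ cs)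

  BoolClo⇒IsCNF : ∀ {a} → BoolClo P a → IsCNF a
  BoolClo⇒IsCNF (gen pa) = P⇒IsCNF pa
  BoolClo⇒IsCNF (cmp a) = IsCNF-∁ (BoolClo⇒IsCNF a)
  BoolClo⇒IsCNF (meet a b) = IsCNF-∩ (BoolClo⇒IsCNF a) (BoolClo⇒IsCNF b)
  BoolClo⇒IsCNF (join a b) = IsCNF-∪ (BoolClo⇒IsCNF a) (BoolClo⇒IsCNF b)
  BoolClo⇒IsCNF (ext a e) = IsCNF-resp-≐ e (BoolClo⇒IsCNF a)

  module _
    (R : X → X → Set)
    (P-ext : ∀ {a b} → P a → a ≐ b → P b)
    (P-arr : ∀ {a b} → P a → P b → P (arr R a b))
    where

    box-⋀∈P : ∀ cs → P (box R (⋀ cs))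
    box-⋀∈P [] = P-ext P-X λ x → (λ _ _ _ → tt) , (λ _ → tt)
    box-⋀∈P (c ∷ cs) =
      P-ext (P-∩ (P-arr (premise∈P c) (conclusion∈P c)) (box-⋀∈P cs))
            (≐-sym (≐-trans (box-∩ R) (∩-cong (box-∁∪ R) ≐-refl)))

    box-BoolClo∈P : ∀ {a} → BoolClo P a → P (box R a)
    box-BoolClo∈P bc =
      let (cs , a≐) = BoolClo⇒IsCNF bc in P-ext (box-⋀∈P cs) (box-cong R (≐-sym a≐))

∘-isMorphism : {F G H : FrameData} → IsEquivalence (FrameData._≈_ H) →
               {f : FrameData.Carrier F → FrameData.Carrier G}
               {g : FrameData.Carrier G → FrameData.Carrier H} →
               IsMorphism F G f → IsMorphism G H g → IsMorphism F H (g ∘ f)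
∘-isMorphism ≈H-isEquivalence f-mor g-mor = record
  { f-cong = g.f-cong ∘ f.f-cong
  ; ⪯-pres = g.⪯-pres ∘ f.⪯-pres
  ; ⊏-pres = g.⊏-pres ∘ f.⊏-pres
  ; ⪯-back = λ gfx⪯z″ →
      let (z′ , fx⪯z′ , gz′≈z″) = g.⪯-back gfx⪯z″
          (z , x⪯z , fz≈z′) = f.⪯-back fx⪯z′
      in z , x⪯z , ≈H.trans (g.f-cong fz≈z′) gz′≈z″
  ; ⊏-back = λ gfx⊏z″ →
      let (z′ , fx⊏z′ , gz′≈z″) = g.⊏-back gfx⊏z″
          (z , x⊏z , fz≈z′) = f.⊏-back fx⊏z′
      in z , x⊏z , ≈H.trans (g.f-cong fz≈z′) gz′≈z″
  ; P-preimage = f.P-preimage ∘ g.P-preimage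
  }
  where
  module f = IsMorphism f-mor
  module g = IsMorphism g-mor
  module ≈H = IsEquivalence ≈H-isEquivalence

module RhoSigma (em : ExcludedMiddle 0ℓ) (G : GFrame) where
  open GFrame G
  open IsGenFrame isGenFrame
  open IsPartialOrder ⪯-isPartialOrder using (antisym) renaming (refl to ⪯-refl; trans to ⪯-trans)
  open NormalForm em P P-X P-∅ P-∩ P-∪ using (box-BoolClo∈P)
  open FrameData (ρ̂σ̂ G) using () renaming (_≈_ to _≈̂_; _⊏_ to _⊏̂_; P to P̂)

  ≈̂-isEquivalence : IsEquivalence _≈̂_
  ≈̂-isEquivalence = record
    { refl = ⪯-refl , ⪯-refl
    ; sym = λ (p , q) → q , p
    ; trans = λ (p , q) (r , s) → ⪯-trans p r , ⪯-trans s q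
    }
  open IsEquivalence ≈̂-isEquivalence using () renaming (refl to ≈̂-refl)

  ≈̂⇒≡ : ∀ {x y} → x ≈̂ y → x ≡ y
  ≈̂⇒≡ (p , q) = antisym p q

  ⊏̂⇒⊏ : ∀ {x y} → x ⊏̂ y → x ⊏ y
  ⊏̂⇒⊏ {x} (y′ , y′≈̂y , w , x⪯w , w⊏y′) = subst (x ⊏_) (≈̂⇒≡ y′≈̂y) (mix x⪯w w⊏y′)

  ⊏⇒⊏̂ : ∀ {x y} → x ⊏ y → x ⊏̂ y
  ⊏⇒⊏̂ {x} {y} x⊏y = y , ≈̂-refl , x , ⪯-refl , x⊏y

  P⇒P̂ : ∀ {a} → P a → P̂ a
  P⇒P̂ {a} pa = a , (λ (x⪯y , _) → P-upset pa x⪯y) , gen pa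
              , λ x → (λ ax y x⪯y → P-upset pa x⪯y ax) , (λ h → h x ⪯-refl)

  P̂⇒P : ∀ {a} → P̂ a → P a
  P̂⇒P (𝒜 , _ , 𝒜∈σ̂P , a≐□𝒜) = P-ext (box-BoolClo∈P _⪯_ P-ext P-→ 𝒜∈σ̂P) (≐-sym a≐□𝒜)

  ρ̂σ̂-isGenFrame : IsGenFrame (ρ̂σ̂ G)
  ρ̂σ̂-isGenFrame = record
    { ≈-isEquivalence = ≈̂-isEquivalence
    ; ⪯-isPartialOrder = record
        { isPreorder = record
            { isEquivalence = ≈̂-isEquivalence
            ; reflexive = proj₁
            ; trans = ⪯-trans
            }
        ; antisym = _,_
        }
    ; ⊏-respˡ = λ x≈̂x′ x⊏̂z → ⊏⇒⊏̂ (subst (_⊏ _) (≈̂⇒≡ x≈̂x′) (⊏̂⇒⊏ x⊏̂z))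
    ; ⊏-respʳ = λ z≈̂z′ x⊏̂z → ⊏⇒⊏̂ (subst (_ ⊏_) (≈̂⇒≡ z≈̂z′) (⊏̂⇒⊏ x⊏̂z))
    ; mix = λ x⪯y y⊏̂z → ⊏⇒⊏̂ (mix x⪯y (⊏̂⇒⊏ y⊏̂z))
    ; P-ext = λ pa a≐b → P⇒P̂ (P-ext (P̂⇒P pa) a≐b)
    ; P-upset = P-upset ∘ P̂⇒P
    ; P-X = P⇒P̂ P-X
    ; P-∅ = P⇒P̂ P-∅
    ; P-∩ = λ pa pb → P⇒P̂ (P-∩ (P̂⇒P pa) (P̂⇒P pb))
    ; P-∪ = λ pa pb → P⇒P̂ (P-∪ (P̂⇒P pa) (P̂⇒P pb))
    ; P-→ = λ pa pb → P⇒P̂ (P-→ (P̂⇒P pa) (P̂⇒P pb))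
    ; P-⇝ = λ pa pb → P⇒P̂ (P-ext (P-⇝ (P̂⇒P pa) (P̂⇒P pb))
              λ x → (λ h y → h y ∘ ⊏̂⇒⊏) , (λ h y → h y ∘ ⊏⇒⊏̂))
    }

  η-isMorphism : IsMorphism data' (ρ̂σ̂ G) (η G)
  η-isMorphism = record
    { f-cong = λ { refl → ≈̂-refl }
    ; ⪯-pres = id
    ; ⊏-pres = ⊏⇒⊏̂
    ; ⪯-back = λ {_} {z} x⪯z → z , x⪯z , ≈̂-refl
    ; ⊏-back = λ {_} {z} x⊏̂z → z , ⊏̂⇒⊏ x⊏̂z , ≈̂-refl
    ; P-preimage = P̂⇒P
    }

  η⁻¹-isMorphism : IsMorphism (ρ̂σ̂ G) data' id
  η⁻¹-isMorphism = record
    { f-cong = ≈̂⇒≡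
    ; ⪯-pres = id
    ; ⊏-pres = ⊏̂⇒⊏
    ; ⪯-back = λ {_} {z} x⪯z → z , x⪯z , refl
    ; ⊏-back = λ {_} {z} x⊏z → z , ⊏⇒⊏̂ x⊏z , refl
    ; P-preimage = P⇒P̂
    }

  η-isIso : IsIso data' (ρ̂σ̂ G) (η G)
  η-isIso = η-isMorphism , id , η⁻¹-isMorphism , (λ _ → refl) , (λ _ → ≈̂-refl)

proposition4p11 : ExcludedMiddle (lsuc 0ℓ) →
    ((G : GFrame) →
    IsGenFrame (ρ̂σ̂ G)
    × IsIso (GFrame.data' G) (ρ̂σ̂ G) (η G)
    × (∀ a → (GFrame.P G a → FrameData.P (ρ̂σ̂ G) a)
    × (FrameData.P (ρ̂σ̂ G) a → GFrame.P G a)))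
    × ((G G' : GFrame) (f : GFrame.X G → GFrame.X G') →
    IsMorphism (GFrame.data' G) (GFrame.data' G') f →
    IsMorphism (ρ̂σ̂ G) (ρ̂σ̂ G') (ρ̂map (σ̂map f))
    × (∀ x → FrameData._≈_ (ρ̂σ̂ G') (ρ̂map (σ̂map f) (η G x)) (η G' (f x))))
proposition4p11 EM =
    (λ G → let open RhoSigma em G in ρ̂σ̂-isGenFrame , η-isIso , λ _ → P⇒P̂ , P̂⇒P)
  , λ G G′ f f-mor →
      let module G = RhoSigma em G
          module G′ = RhoSigma em G′
      in ∘-isMorphism G′.≈̂-isEquivalence
           (∘-isMorphism isEquivalence G.η⁻¹-isMorphism f-mor) G′.η-isMorphism
       , λ _ → IsEquivalence.refl G′.≈̂-isEquivalence
  where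
  em : ExcludedMiddle 0ℓ
  em = lowerExcludedMiddle EM
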